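{- There exist constants $c,d\in\mathbb{N}$ such that, with $f(n,p) = c\cdot n\cdot|p| + d$, the following holds for every $\mathrm{IMP}^{\mathrm{WC}}$ program $p$, all states $s,s'$, and all $n$: 1. If $p, s\Rightarrow^{n}_{\mathrm{vars}(p)} s'$, then $I(p), s\Rightarrow^{f(n,p)}_{\mathrm{vars}(p)} s'$. 2. If $I(p), s\Rightarrow^{n}_{\mathrm{vars}(p)} s'$, then $p, s\Rightarrow^{n}_{\mathrm{vars}(p)} s'$.
   Context: **States and notation.** Registers are strings; states are functions $s:\mathrm{string}\to\mathbb{N}$; $s[r:=v]$ denotes a state update. $\mathrm{vars}(p)$ is the set of registers occurring in $p$, and $|p|$ is the size of $p$. **IMP^W.** $\mathrm{IMP}^{\mathrm{W}}$ has $r:=a$ (with $a$ a constant, a register, or $A_1\pm A_2$ with $A_i$ constants or registers, using truncated subtraction), $p_1;p_2$, $\mathrm{IF}\ r\neq 0\ \mathrm{THEN}\ p_1\ \mathrm{ELSE}\ p_2$, and $\mathrm{WHILE}\ r\neq 0\ \mathrm{DO}\ p$. It has the standard exact-time big-step relation $p,s\Rightarrow^n s'$, with a fixed constant cost added per construct executed. **IMP^WC.** $\mathrm{IMP}^{\mathrm{WC}}$ additionally has $\mathrm{CALL}\ pc\ \mathrm{RETURN}\ r$, where $pc$ is an $\mathrm{IMP}^{\mathrm{W}}$ program (so it contains no calls), with the rule: if some $n'\le n$ and $s''$ satisfy $pc,s\Rightarrow^{n'}s''$ and $s''(r)=v$, then $\mathrm{CALL}\ pc\ \mathrm{RETURN}\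 r, s\Rightarrow^n s[r:=v]$. **Relaxed relation.** For a set $R$ of registers, $p,s\Rightarrow^n_R s'$ means: there exist $n'\le n$ and $s''$ with $p,s\Rightarrow^{n'}s''$ and $s'(r)=s''(r)$ for all $r\in R$. **Inlining.** For a call $\mathrm{CALL}\ p^w\ \mathrm{RETURN}\ r$ with $\mathrm{vars}(p^w)=\{r_1,\dots,r_k\}$, let $m$ be an injective renaming of registers to fresh registers. The call is replaced by $$m(r_1):=r_1;\ \dots;\ m(r_k):=r_k;\ p^w[m\,x/x];\ r:=m(r),$$ where $p^w[m\,x/x]$ renames every register $x$ of $p^w$ to $m(x)$. The $\mathrm{IMP}^{\mathrm{W}}$ program $I(p)$ is obtained from $p$ by inlining all calls in this way. -}

module Defs where

open import Data.Nat using (ℕ; zero; suc; _+_; _∸_; _≤_)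
open import Data.String using (String; _≟_)
open import Data.List using (List; []; _∷_; _++_; [_]; deduplicate)
open import Data.Product using (∃; _×_; _,_)
open import Relation.Nullary.Decidable using (⌊_⌋)
open import Data.Bool using (if_then_else_)
open import Relation.Binary.PropositionalEquality using (_≡_)
open import Data.List.Membership.Propositional using (_∈_)

Reg : Set
Reg = String

State : Set
State = Reg → ℕ

_[_:=_] : State → Reg → ℕ → State
s [ r := v ] = λ x → if ⌊ x ≟ r ⌋ then v else s x

data Atom : Set where
  N : ℕ → Atom
  R : Reg → Atom

data AExp : Set where
  A     : Atom → AExp
  Plus  : Atom → Atom → AExp
  Minus : Atom → Atom → AExp

atomVal : Atom → State → ℕ
atomVal (N k) s = k
atomVal (R r) s = s r

aval : AExp → State → ℕ
aval (A a)         s = atomVal a s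
aval (Plus a₁ a₂)  s = atomVal a₁ s + atomVal a₂ s
aval (Minus a₁ a₂) s = atomVal a₁ s ∸ atomVal a₂ s

infixr 5 _⨾_
data Com : Set where
  _≔_   : Reg → AExp → Com
  _⨾_   : Com → Com → Com
  IF_THEN_ELSE_ : Reg → Com → Com → Com
  WHILE_DO_     : Reg → Com → Com

data CCom : Set where
  _≔_   : Reg → AExp → CCom
  _⨾_   : CCom → CCom → CCom
  IF_THEN_ELSE_ : Reg → CCom → CCom → CCom
  WHILE_DO_     : Reg → CCom → CCom
  CALL_RETURN_  : Com → Reg → CCom

atomVars : Atom → List Reg
atomVars (N _) = []
atomVars (R r) = [ r ]

aexpVars : AExp → List Reg
aexpVars (A a)         = atomVars a
aexpVars (Plus a₁ a₂)  = atomVars a₁ ++ atomVars a₂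
aexpVars (Minus a₁ a₂) = atomVars a₁ ++ atomVars a₂

vars : Com → List Reg
vars (r ≔ a)                 = r ∷ aexpVars a
vars (p₁ ⨾ p₂)               = vars p₁ ++ vars p₂
vars (IF r THEN p₁ ELSE p₂)  = r ∷ vars p₁ ++ vars p₂
vars (WHILE r DO p)          = r ∷ vars p

varsC : CCom → List Reg
varsC (r ≔ a)                = r ∷ aexpVars a
varsC (p₁ ⨾ p₂)              = varsC p₁ ++ varsC p₂
varsC (IF r THEN p₁ ELSE p₂) = r ∷ varsC p₁ ++ varsC p₂
varsC (WHILE r DO p)         = r ∷ varsC p
varsC (CALL pc RETURN r)     = r ∷ vars pc

size : Com → ℕ
size (r ≔ a)                = 1
size (p₁ ⨾ p₂)              = suc (size p₁ + size p₂)
size (IF r THEN p₁ ELSE p₂) = suc (size p₁ + size p₂)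
size (WHILE r DO p)         = suc (size p)

sizeC : CCom → ℕ
sizeC (r ≔ a)                = 1
sizeC (p₁ ⨾ p₂)              = suc (sizeC p₁ + sizeC p₂)
sizeC (IF r THEN p₁ ELSE p₂) = suc (sizeC p₁ + sizeC p₂)
sizeC (WHILE r DO p)         = suc (sizeC p)
sizeC (CALL pc RETURN r)     = suc (size pc)

-- Exact-time big-step semantics of IMP^W  (p , s ⇒⟨ n ⟩ s')
-- Costs (as in IMP-): assignment 2, sequence n₁+n₂, IF 1+n,
-- WHILE (false) 2, WHILE (true) 1+n₁+n₂.

data _,_⇒⟨_⟩_ : Com → State → ℕ → State → Set where
  Assign : ∀ {r a s} → (r ≔ a) , s ⇒⟨ 2 ⟩ (s [ r := aval a s ])
  Seq    : ∀ {p₁ p₂ s₁ s₂ s₃ n₁ n₂} →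
           p₁ , s₁ ⇒⟨ n₁ ⟩ s₂ → p₂ , s₂ ⇒⟨ n₂ ⟩ s₃ →
           (p₁ ⨾ p₂) , s₁ ⇒⟨ n₁ + n₂ ⟩ s₃
  IfTrue : ∀ {r p₁ p₂ s s' n k} → s r ≡ suc k →
           p₁ , s ⇒⟨ n ⟩ s' → (IF r THEN p₁ ELSE p₂) , s ⇒⟨ suc n ⟩ s'
  IfFalse : ∀ {r p₁ p₂ s s' n} → s r ≡ 0 →
           p₂ , s ⇒⟨ n ⟩ s' → (IF r THEN p₁ ELSE p₂) , s ⇒⟨ suc n ⟩ s'
  WhileFalse : ∀ {r p s} → s r ≡ 0 → (WHILE r DO p) , s ⇒⟨ 2 ⟩ s
  WhileTrue  : ∀ {r p s₁ s₂ s₃ n₁ n₂ k} → s₁ r ≡ suc k →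
           p , s₁ ⇒⟨ n₁ ⟩ s₂ → (WHILE r DO p) , s₂ ⇒⟨ n₂ ⟩ s₃ →
           (WHILE r DO p) , s₁ ⇒⟨ suc (n₁ + n₂) ⟩ s₃

data _,_⇒ᶜ⟨_⟩_ : CCom → State → ℕ → State → Set where
  Assign : ∀ {r a s} → (r ≔ a) , s ⇒ᶜ⟨ 2 ⟩ (s [ r := aval a s ])
  Seq    : ∀ {p₁ p₂ s₁ s₂ s₃ n₁ n₂} →
           p₁ , s₁ ⇒ᶜ⟨ n₁ ⟩ s₂ → p₂ , s₂ ⇒ᶜ⟨ n₂ ⟩ s₃ →
           (p₁ ⨾ p₂) , s₁ ⇒ᶜ⟨ n₁ + n₂ ⟩ s₃
  IfTrue : ∀ {r p₁ p₂ s s' n k} → s r ≡ suc k →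
           p₁ , s ⇒ᶜ⟨ n ⟩ s' → (IF r THEN p₁ ELSE p₂) , s ⇒ᶜ⟨ suc n ⟩ s'
  IfFalse : ∀ {r p₁ p₂ s s' n} → s r ≡ 0 →
           p₂ , s ⇒ᶜ⟨ n ⟩ s' → (IF r THEN p₁ ELSE p₂) , s ⇒ᶜ⟨ suc n ⟩ s'
  WhileFalse : ∀ {r p s} → s r ≡ 0 → (WHILE r DO p) , s ⇒ᶜ⟨ 2 ⟩ s
  WhileTrue  : ∀ {r p s₁ s₂ s₃ n₁ n₂ k} → s₁ r ≡ suc k →
           p , s₁ ⇒ᶜ⟨ n₁ ⟩ s₂ → (WHILE r DO p) , s₂ ⇒ᶜ⟨ n₂ ⟩ s₃ →
           (WHILE r DO p) , s₁ ⇒ᶜ⟨ suc (n₁ + n₂) ⟩ s₃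
  Call   : ∀ {pc r s s'' n' n v} → n' ≤ n →
           pc , s ⇒⟨ n' ⟩ s'' → s'' r ≡ v →
           (CALL pc RETURN r) , s ⇒ᶜ⟨ n ⟩ (s [ r := v ])

_,_⇒⟨_⟩[_]_ : Com → State → ℕ → List Reg → State → Set
p , s ⇒⟨ n ⟩[ Rs ] s' =
  ∃ λ n' → ∃ λ s'' → n' ≤ n × (p , s ⇒⟨ n' ⟩ s'') × (∀ r → r ∈ Rs → s' r ≡ s'' r)

_,_⇒ᶜ⟨_⟩[_]_ : CCom → State → ℕ → List Reg → State → Set
p , s ⇒ᶜ⟨ n ⟩[ Rs ] s' =
  ∃ λ n' → ∃ λ s'' → n' ≤ n × (p , s ⇒ᶜ⟨ n' ⟩ s'') × (∀ r → r ∈ Rs → s' r ≡ s'' r)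

renAtom : (Reg → Reg) → Atom → Atom
renAtom m (N k) = N k
renAtom m (R r) = R (m r)

renAExp : (Reg → Reg) → AExp → AExp
renAExp m (A a)         = A (renAtom m a)
renAExp m (Plus a₁ a₂)  = Plus (renAtom m a₁) (renAtom m a₂)
renAExp m (Minus a₁ a₂) = Minus (renAtom m a₁) (renAtom m a₂)

rename : (Reg → Reg) → Com → Com
rename m (r ≔ a)                = m r ≔ renAExp m a
rename m (p₁ ⨾ p₂)              = rename m p₁ ⨾ rename m p₂
rename m (IF r THEN p₁ ELSE p₂) = IF m r THEN rename m p₁ ELSE rename m p₂
rename m (WHILE r DO p)         = WHILE m r DO rename m p

copyIn : (Reg → Reg) → List Reg → Com → Com
copyIn m []       rest = rest
copyIn m (x ∷ xs) rest = (m x ≔ A (R x)) ⨾ copyIn m xs rest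

callRegs : Com → Reg → List Reg
callRegs pw r = deduplicate _≟_ (vars pw ++ [ r ])

inlineCall : (Reg → Reg) → Com → Reg → Com
inlineCall m pw r = copyIn m (callRegs pw r) (rename m pw ⨾ (r ≔ A (R (m r))))

inline : (Reg → Reg) → CCom → Com
inline m (r ≔ a)                = r ≔ a
inline m (p₁ ⨾ p₂)              = inline m p₁ ⨾ inline m p₂
inline m (IF r THEN p₁ ELSE p₂) = IF r THEN inline m p₁ ELSE inline m p₂
inline m (WHILE r DO p)         = WHILE r DO inline m p
inline m (CALL pw RETURN r)     = inlineCall m pw r

{-# OPTIONS --safe #-}
-- Inlining is simulated step by step. The only interesting case is a call: after the
-- copy-in block the fresh registers m x hold the values of the registers x, so the renamed
-- body runs exactly like the original body, and it touches no register of p, because the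
-- image of m avoids vars(p). The inlined call costs its body's time plus two units per
-- copied register and for the return, which is at most linear in |p|, while a call takes
-- at least one unit of time; hence every unit of time costs at most 6·|p| after inlining.
module Submission where

open import Defs
open import Data.Nat using (ℕ; zero; suc; _+_; _*_; _∸_; _≤_; _<_; z≤n; s≤s)
open import Data.Nat.Properties
  using ( ≤-trans; ≤-reflexive; ≤-refl; m≤m+n; m≤n+m; m≤n⇒m≤1+n; n≤1+n; m≤m*n; m≤n*m
        ; <⇒≤; m+n≤o⇒m≤o; m+n≤o⇒n≤o
        ; +-mono-≤; +-monoˡ-≤; +-monoʳ-≤; *-monoˡ-≤; *-monoʳ-≤; +-suc; +-comm; +-assoc
        ; *-distribʳ-+; module ≤-Reasoning )
open import Data.Nat.Tactic.RingSolver using (solve-∀)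
open import Data.List using (List; []; _∷_; _++_; [_]; length)
open import Data.List.Properties using (length-++; length-deduplicate)
open import Data.List.Membership.Propositional using (_∈_; _∉_)
open import Data.List.Membership.Propositional.Properties
  using (∈-deduplicate⁺; ∈-deduplicate⁻; ∈-++⁻)
open import Data.List.Relation.Binary.Subset.Propositional using (_⊆_)
open import Data.List.Relation.Binary.Subset.Propositional.Properties
  using (xs⊆xs++ys; xs⊆ys++xs)
open import Data.List.Relation.Unary.Any using (here; there)
open import Data.Product using (∃; _×_; _,_)
open import Data.Sum using (inj₁; inj₂)
open import Data.String using (_≟_)
open import Data.List.Membership.DecPropositional _≟_ using (_∈?_)
open import Data.Empty using (⊥-elim)
open import Function using (_∘_; id)
open import Function.Definitions using (Injective)
open import Relation.Binary.PropositionalEquality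
  using (_≡_; _≢_; _≗_; refl; sym; trans; cong; cong₂; subst)
open import Relation.Nullary using (yes; no)

[:=]-same : ∀ (s : State) r v → (s [ r := v ]) r ≡ v
[:=]-same s r v with r ≟ r
... | yes _   = refl
... | no r≢r = ⊥-elim (r≢r refl)

[:=]-other : ∀ (s : State) {r y} v → y ≢ r → (s [ r := v ]) y ≡ s y
[:=]-other s {r} {y} v y≢r with y ≟ r
... | yes y≡r = ⊥-elim (y≢r y≡r)
... | no _    = refl

[:=]-∘ : ∀ {m : Reg → Reg} → Injective _≡_ _≡_ m →
         ∀ (t : State) r v → (t [ m r := v ]) ∘ m ≗ (t ∘ m) [ r := v ]
[:=]-∘ {m} m-inj t r v x with x ≟ r | m x ≟ m r
... | yes _    | yes _     = refl
... | yes refl | no mr≢mr  = ⊥-elim (mr≢mr refl)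
... | no x≢r   | yes mx≡mr = ⊥-elim (x≢r (m-inj mx≡mr))
... | no _     | no _      = refl

Agree : List Reg → State → State → Set
Agree X s s' = ∀ x → x ∈ X → s x ≡ s' x

Agree-refl : ∀ {X s} → Agree X s s
Agree-refl _ _ = refl

Agree-sym : ∀ {X s s'} → Agree X s s' → Agree X s' s
Agree-sym s≈s' x x∈X = sym (s≈s' x x∈X)

Agree-trans : ∀ {X s s' s''} → Agree X s s' → Agree X s' s'' → Agree X s s''
Agree-trans s≈s' s'≈s'' x x∈X = trans (s≈s' x x∈X) (s'≈s'' x x∈X)

Agree-guard : ∀ {X r xs s s' v} → Agree X s s' → r ∷ xs ⊆ X → s r ≡ v → s' r ≡ v
Agree-guard s≈s' r∷xs⊆X s≡v = trans (sym (s≈s' _ (r∷xs⊆X (here refl)))) s≡v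

Agree-⊆ : ∀ {X Y s s'} → X ⊆ Y → Agree Y s s' → Agree X s s'
Agree-⊆ X⊆Y s≈s' x x∈X = s≈s' x (X⊆Y x∈X)

Agree-[:=] : ∀ {X s s'} r {v v'} → Agree X s s' → v ≡ v' → Agree X (s [ r := v ]) (s' [ r := v' ])
Agree-[:=] r s≈s' v≡v' x x∈X with x ≟ r
... | yes _ = v≡v'
... | no _  = s≈s' x x∈X

atomVal-agree : ∀ {X s s'} a → atomVars a ⊆ X → Agree X s s' → atomVal a s ≡ atomVal a s'
atomVal-agree (N k) _   _    = refl
atomVal-agree (R r) a⊆X s≈s' = s≈s' r (a⊆X (here refl))

aval-agree : ∀ {X s s'} a → aexpVars a ⊆ X → Agree X s s' → aval a s ≡ aval a s'
aval-agree (A a) a⊆X s≈s' = atomVal-agree a a⊆X s≈s'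
aval-agree (Plus a₁ a₂) a⊆X s≈s' =
  cong₂ _+_ (atomVal-agree a₁ (a⊆X ∘ xs⊆xs++ys _ _) s≈s') (atomVal-agree a₂ (a⊆X ∘ xs⊆ys++xs _ _) s≈s')
aval-agree (Minus a₁ a₂) a⊆X s≈s' =
  cong₂ _∸_ (atomVal-agree a₁ (a⊆X ∘ xs⊆xs++ys _ _) s≈s') (atomVal-agree a₂ (a⊆X ∘ xs⊆ys++xs _ _) s≈s')

atomVal-renAtom : ∀ m a (t : State) → atomVal (renAtom m a) t ≡ atomVal a (t ∘ m)
atomVal-renAtom m (N k) t = refl
atomVal-renAtom m (R r) t = refl

aval-renAExp : ∀ m a (t : State) → aval (renAExp m a) t ≡ aval a (t ∘ m)
aval-renAExp m (A a)         t = atomVal-renAtom m a t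
aval-renAExp m (Plus a₁ a₂)  t = cong₂ _+_ (atomVal-renAtom m a₁ t) (atomVal-renAtom m a₂ t)
aval-renAExp m (Minus a₁ a₂) t = cong₂ _∸_ (atomVal-renAtom m a₁ t) (atomVal-renAtom m a₂ t)

⇒[]-mono : ∀ {p s n n' Rs s' s''} → n ≤ n' → Agree Rs s' s'' →
           p , s ⇒⟨ n ⟩[ Rs ] s'' → p , s ⇒⟨ n' ⟩[ Rs ] s'
⇒[]-mono n≤n' s'≈s'' (k , t , k≤n , run , s''≈t) =
  k , t , ≤-trans k≤n n≤n' , run , Agree-trans s'≈s'' s''≈t

⇒-time-positive : ∀ {p s n s'} → p , s ⇒⟨ n ⟩ s' → 1 ≤ n
⇒-time-positive Assign            = s≤s z≤n
⇒-time-positive (Seq run₁ _)      = ≤-trans (⇒-time-positive run₁) (m≤m+n _ _)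
⇒-time-positive (IfTrue _ _)      = s≤s z≤n
⇒-time-positive (IfFalse _ _)     = s≤s z≤n
⇒-time-positive (WhileFalse _)    = s≤s z≤n
⇒-time-positive (WhileTrue _ _ _) = s≤s z≤n

atomVars-length : ∀ a → length (atomVars a) ≤ 1
atomVars-length (N _) = z≤n
atomVars-length (R _) = s≤s z≤n

atomVars-++-length : ∀ a₁ a₂ → length (atomVars a₁ ++ atomVars a₂) ≤ 2
atomVars-++-length a₁ a₂ =
  ≤-trans (≤-reflexive (length-++ (atomVars a₁))) (+-mono-≤ (atomVars-length a₁) (atomVars-length a₂))

aexpVars-length : ∀ a → length (aexpVars a) ≤ 2
aexpVars-length (A a)         = m≤n⇒m≤1+n (atomVars-length a)
aexpVars-length (Plus a₁ a₂)  = atomVars-++-length a₁ a₂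
aexpVars-length (Minus a₁ a₂) = atomVars-++-length a₁ a₂

vars-length : ∀ q → length (vars q) ≤ size q * 3
vars-++-length : ∀ p₁ p₂ → length (vars p₁ ++ vars p₂) ≤ (size p₁ + size p₂) * 3

vars-length (r ≔ a)                = s≤s (aexpVars-length a)
vars-length (p₁ ⨾ p₂)              = ≤-trans (vars-++-length p₁ p₂) (m≤n+m _ 3)
vars-length (IF r THEN p₁ ELSE p₂) = s≤s (≤-trans (vars-++-length p₁ p₂) (m≤n+m _ 2))
vars-length (WHILE r DO p)         = s≤s (≤-trans (vars-length p) (m≤n+m _ 2))

vars-++-length p₁ p₂ = begin
  length (vars p₁ ++ vars p₂)             ≡⟨ length-++ (vars p₁) ⟩
  length (vars p₁) + length (vars p₂)     ≤⟨ +-mono-≤ (vars-length p₁) (vars-length p₂) ⟩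
  size p₁ * 3 + size p₂ * 3               ≡⟨ *-distribʳ-+ 3 (size p₁) (size p₂) ⟨
  (size p₁ + size p₂) * 3                 ∎
  where open ≤-Reasoning

callRegs-length : ∀ pc r → length (callRegs pc r) ≤ size pc * 3 + 1
callRegs-length pc r = begin
  length (callRegs pc r)     ≤⟨ length-deduplicate _≟_ (vars pc ++ [ r ]) ⟩
  length (vars pc ++ [ r ])  ≡⟨ length-++ (vars pc) ⟩
  length (vars pc) + 1       ≤⟨ +-monoˡ-≤ 1 (vars-length pc) ⟩
  size pc * 3 + 1            ∎
  where open ≤-Reasoning

vars⊆callRegs : ∀ pc r → vars pc ⊆ callRegs pc r
vars⊆callRegs pc r = ∈-deduplicate⁺ _≟_ ∘ xs⊆xs++ys _ _

∈-callRegs : ∀ pc r → r ∈ callRegs pc r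
∈-callRegs pc r = ∈-deduplicate⁺ _≟_ (xs⊆ys++xs [ r ] (vars pc) (here refl))

callRegs⊆varsC : ∀ pc r → callRegs pc r ⊆ varsC (CALL pc RETURN r)
callRegs⊆varsC pc r x∈L with ∈-++⁻ (vars pc) (∈-deduplicate⁻ _≟_ (vars pc ++ [ r ]) x∈L)
... | inj₁ x∈vars    = there x∈vars
... | inj₂ (here eq) = here eq

≤-*-distrib-+ : ∀ {K k₁ k₂} n₁ n₂ → k₁ ≤ n₁ * K → k₂ ≤ n₂ * K → k₁ + k₂ ≤ (n₁ + n₂) * K
≤-*-distrib-+ {K} n₁ n₂ k₁≤ k₂≤ =
  ≤-trans (+-mono-≤ k₁≤ k₂≤) (≤-reflexive (sym (*-distribʳ-+ K n₁ n₂)))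

≤-*-suc : ∀ {K k} n → 1 ≤ K → k ≤ n * K → suc k ≤ suc n * K
≤-*-suc n = +-mono-≤

m+n<o⇒m≤o : ∀ {m n o} → m + n < o → m ≤ o
m+n<o⇒m≤o = m+n≤o⇒m≤o _ ∘ <⇒≤

m+n<o⇒n≤o : ∀ {m n o} → m + n < o → n ≤ o
m+n<o⇒n≤o = m+n≤o⇒n≤o _ ∘ <⇒≤

suc≤⇒1≤6* : ∀ {x S} → suc x ≤ S → 1 ≤ 6 * S
suc≤⇒1≤6* x<S = ≤-trans (s≤s z≤n) (≤-trans x<S (m≤n*m _ 6))

+-≤-*-suc : ∀ k {n' n} → 1 ≤ n' → n' ≤ n → k + n' ≤ n * suc k
+-≤-*-suc k {n = zero}   (s≤s _) ()
+-≤-*-suc k {n = suc n₀} _ n'≤n = begin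
  k + _                 ≤⟨ +-monoʳ-≤ k n'≤n ⟩
  k + suc n₀            ≡⟨ +-suc k n₀ ⟩
  suc k + n₀            ≤⟨ +-monoʳ-≤ (suc k) (m≤m*n n₀ (suc k)) ⟩
  suc k + n₀ * suc k    ∎
  where open ≤-Reasoning

-- The time of an inlined call: two units per copied register, the body, and the return.
call-time : ∀ {pc r n' n S} → 1 ≤ n' → n' ≤ n → sizeC (CALL pc RETURN r) ≤ S →
            length (callRegs pc r) * 2 + (n' + 2) ≤ n * (6 * S)
call-time {pc} {r} {n'} {n} {S} 1≤n' n'≤n call≤S = begin
  l * 2 + (n' + 2)    ≡⟨ cong (l * 2 +_) (+-comm n' 2) ⟩
  l * 2 + (2 + n')    ≡⟨ +-assoc (l * 2) 2 n' ⟨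
  (l * 2 + 2) + n'    ≤⟨ +-≤-*-suc (l * 2 + 2) 1≤n' n'≤n ⟩
  n * suc (l * 2 + 2) ≤⟨ *-monoʳ-≤ n overhead-≤ ⟩
  n * (6 * S)         ∎
  where
  open ≤-Reasoning
  l z : ℕ
  l = length (callRegs pc r)
  z = size pc
  overhead-≤ : suc (l * 2 + 2) ≤ 6 * S
  overhead-≤ = begin
    suc (l * 2 + 2)                  ≤⟨ s≤s (+-monoˡ-≤ 2 (*-monoˡ-≤ 2 (callRegs-length pc r))) ⟩
    suc ((z * 3 + 1) * 2 + 2)        ≤⟨ n≤1+n _ ⟩
    suc (suc ((z * 3 + 1) * 2 + 2))  ≡⟨ six-times-suc z ⟩
    6 * suc z                        ≤⟨ *-monoʳ-≤ 6 call≤S ⟩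
    6 * S                            ∎
    where
    six-times-suc : ∀ z → suc (suc ((z * 3 + 1) * 2 + 2)) ≡ 6 * suc z
    six-times-suc = solve-∀

module _ (m : Reg → Reg) (m-inj : Injective _≡_ _≡_ m) where

  Agree-[:=]-∘ : ∀ {X s t} r {v v'} → Agree X s (t ∘ m) → v ≡ v' →
                 Agree X (s [ r := v ]) ((t [ m r := v' ]) ∘ m)
  Agree-[:=]-∘ {t = t} r {v' = v'} s≈t v≡v' x x∈X =
    trans (Agree-[:=] r s≈t v≡v' x x∈X) (sym ([:=]-∘ m-inj t r v' x))

  aval-rename : ∀ {X s} a (t : State) → aexpVars a ⊆ X → Agree X s (t ∘ m) →
                aval a s ≡ aval (renAExp m a) t
  aval-rename a t a⊆X s≈t = trans (aval-agree a a⊆X s≈t) (sym (aval-renAExp m a t))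

  rename-simulates : ∀ {X q s s' n t} → vars q ⊆ X → q , s ⇒⟨ n ⟩ s' → Agree X s (t ∘ m) →
                     ∃ λ t' → (rename m q , t ⇒⟨ n ⟩ t') × Agree X s' (t' ∘ m)
  rename-simulates {q = r ≔ a} {t = t} q⊆X Assign s≈t =
    _ , Assign , Agree-[:=]-∘ {t = t} r s≈t (aval-rename a t (q⊆X ∘ there) s≈t)
  rename-simulates q⊆X (Seq run₁ run₂) s≈t =
    let t₁ , run₁' , s₁≈t₁ = rename-simulates (q⊆X ∘ xs⊆xs++ys _ _) run₁ s≈t
        t₂ , run₂' , s₂≈t₂ = rename-simulates (q⊆X ∘ xs⊆ys++xs _ _) run₂ s₁≈t₁
    in t₂ , Seq run₁' run₂' , s₂≈t₂
  rename-simulates q⊆X (IfTrue r≡ run) s≈t =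
    let t' , run' , s'≈t' = rename-simulates (q⊆X ∘ there ∘ xs⊆xs++ys _ _) run s≈t
    in t' , IfTrue (Agree-guard s≈t q⊆X r≡) run' , s'≈t'
  rename-simulates q⊆X (IfFalse r≡ run) s≈t =
    let t' , run' , s'≈t' = rename-simulates (q⊆X ∘ there ∘ xs⊆ys++xs _ _) run s≈t
    in t' , IfFalse (Agree-guard s≈t q⊆X r≡) run' , s'≈t'
  rename-simulates {t = t} q⊆X (WhileFalse r≡) s≈t =
    t , WhileFalse (Agree-guard s≈t q⊆X r≡) , s≈t
  rename-simulates q⊆X (WhileTrue r≡ run₁ run₂) s≈t =
    let t₁ , run₁' , s₁≈t₁ = rename-simulates (q⊆X ∘ there) run₁ s≈t
        t₂ , run₂' , s₂≈t₂ = rename-simulates q⊆X run₂ s₁≈t₁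
    in t₂ , WhileTrue (Agree-guard s≈t q⊆X r≡) run₁' run₂' , s₂≈t₂

  rename-reflects : ∀ {X} q {t t' n s} → vars q ⊆ X → rename m q , t ⇒⟨ n ⟩ t' →
                    Agree X s (t ∘ m) → ∃ λ s' → (q , s ⇒⟨ n ⟩ s') × Agree X s' (t' ∘ m)
  rename-reflects (r ≔ a) {t} q⊆X Assign s≈t =
    _ , Assign , Agree-[:=]-∘ {t = t} r s≈t (aval-rename a t (q⊆X ∘ there) s≈t)
  rename-reflects (p₁ ⨾ p₂) q⊆X (Seq run₁ run₂) s≈t =
    let s₁ , run₁' , s₁≈t₁ = rename-reflects p₁ (q⊆X ∘ xs⊆xs++ys _ _) run₁ s≈t
        s₂ , run₂' , s₂≈t₂ = rename-reflects p₂ (q⊆X ∘ xs⊆ys++xs _ _) run₂ s₁≈t₁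
    in s₂ , Seq run₁' run₂' , s₂≈t₂
  rename-reflects (IF r THEN p₁ ELSE _) q⊆X (IfTrue r≡ run) s≈t =
    let s' , run' , s'≈t' = rename-reflects p₁ (q⊆X ∘ there ∘ xs⊆xs++ys _ _) run s≈t
    in s' , IfTrue (Agree-guard (Agree-sym s≈t) q⊆X r≡) run' , s'≈t'
  rename-reflects (IF r THEN _ ELSE p₂) q⊆X (IfFalse r≡ run) s≈t =
    let s' , run' , s'≈t' = rename-reflects p₂ (q⊆X ∘ there ∘ xs⊆ys++xs _ _) run s≈t
    in s' , IfFalse (Agree-guard (Agree-sym s≈t) q⊆X r≡) run' , s'≈t'
  rename-reflects (WHILE r DO _) {s = s} q⊆X (WhileFalse r≡) s≈t =
    s , WhileFalse (Agree-guard (Agree-sym s≈t) q⊆X r≡) , s≈t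
  rename-reflects (WHILE r DO p) q⊆X (WhileTrue r≡ run₁ run₂) s≈t =
    let s₁ , run₁' , s₁≈t₁ = rename-reflects p (q⊆X ∘ there) run₁ s≈t
        s₂ , run₂' , s₂≈t₂ = rename-reflects (WHILE r DO p) q⊆X run₂ s₁≈t₁
    in s₂ , WhileTrue (Agree-guard (Agree-sym s≈t) q⊆X r≡) run₁' run₂' , s₂≈t₂

  rename-frame : ∀ q {t t' n y} → rename m q , t ⇒⟨ n ⟩ t' → (∀ x → m x ≢ y) → t' y ≡ t y
  rename-frame (r ≔ a) {t} Assign y∉m = [:=]-other t _ (y∉m r ∘ sym)
  rename-frame (p₁ ⨾ p₂) (Seq run₁ run₂) y∉m =
    trans (rename-frame p₂ run₂ y∉m) (rename-frame p₁ run₁ y∉m)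
  rename-frame (IF _ THEN p₁ ELSE _) (IfTrue _ run) y∉m = rename-frame p₁ run y∉m
  rename-frame (IF _ THEN _ ELSE p₂) (IfFalse _ run) y∉m = rename-frame p₂ run y∉m
  rename-frame (WHILE _ DO _) (WhileFalse _) y∉m = refl
  rename-frame (WHILE r DO p) (WhileTrue _ run₁ run₂) y∉m =
    trans (rename-frame (WHILE r DO p) run₂ y∉m) (rename-frame p run₁ y∉m)

  afterCopy : List Reg → State → State
  afterCopy []       u = u
  afterCopy (x ∷ xs) u = afterCopy xs (u [ m x := u x ])

  copyIn-run : ∀ L {rest u k w} → rest , afterCopy L u ⇒⟨ k ⟩ w →
               copyIn m L rest , u ⇒⟨ length L * 2 + k ⟩ w
  copyIn-run []       run = run
  copyIn-run (x ∷ xs) run = Seq Assign (copyIn-run xs run)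

  copyIn-inv : ∀ L {rest u n w} → copyIn m L rest , u ⇒⟨ n ⟩ w →
               ∃ λ k → n ≡ length L * 2 + k × (rest , afterCopy L u ⇒⟨ k ⟩ w)
  copyIn-inv []       run = _ , refl , run
  copyIn-inv (x ∷ xs) (Seq Assign run) with copyIn-inv xs run
  ... | k , refl , run' = k , refl , run'

  afterCopy-frame : ∀ L u {y} → (∀ {x} → x ∈ L → m x ≢ y) → afterCopy L u y ≡ u y
  afterCopy-frame []       u y∉mL = refl
  afterCopy-frame (x ∷ xs) u y∉mL =
    trans (afterCopy-frame xs _ (y∉mL ∘ there)) ([:=]-other u _ (y∉mL (here refl) ∘ sym))

  -- If x occurs again in ys, a later copy writes m x once more (with the same value).
  afterCopy-agree : ∀ L u → (∀ w → m w ∉ L) → Agree L u (afterCopy L u ∘ m)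
  afterCopy-agree (y ∷ ys) u mw∉L x x∈L with x ∈? ys | x∈L
  ... | yes x∈ys | _ =
    trans (sym ([:=]-other u _ λ x≡my → mw∉L y (subst (_∈ y ∷ ys) x≡my x∈L)))
          (afterCopy-agree ys _ (λ w → mw∉L w ∘ there) x x∈ys)
  ... | no x∉ys | here refl =
    sym (trans (afterCopy-frame ys _ λ z∈ys mz≡mx → x∉ys (subst (_∈ ys) (m-inj mz≡mx) z∈ys))
               ([:=]-same u (m x) (u x)))
  ... | no x∉ys | there x∈ys = ⊥-elim (x∉ys x∈ys)

  module _ (V : List Reg) (mx∉V : ∀ x → m x ∉ V) where

    not-renamed : ∀ {y} → y ∈ V → ∀ x → m x ≢ y
    not-renamed y∈V x mx≡y = mx∉V x (subst (_∈ V) (sym mx≡y) y∈V)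

    call-entry : ∀ {L s u} → L ⊆ V → Agree V s u → Agree L s (afterCopy L u ∘ m)
    call-entry {L} L⊆V s≈u =
      Agree-trans (Agree-⊆ L⊆V s≈u) (afterCopy-agree L _ (λ w → mx∉V w ∘ L⊆V))

    call-exit : ∀ {L pc r s u s' t n} → r ∈ L → Agree V s u → Agree L s' (t ∘ m) →
                rename m pc , afterCopy L u ⇒⟨ n ⟩ t →
                Agree V (s [ r := s' r ]) (t [ r := t (m r) ])
    call-exit {L} {pc} {r} {s} {u} {s'} {t} r∈L s≈u s'≈t run =
      Agree-[:=] r (Agree-trans s≈u u≈t) (s'≈t r r∈L)
      where
      u≈t : Agree V u t
      u≈t y y∈V = sym (trans (rename-frame pc run (not-renamed y∈V))
                             (afterCopy-frame L u λ {x} _ → not-renamed y∈V x))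

    inline-simulates : ∀ {q s s' n u S} → varsC q ⊆ V → sizeC q ≤ S → q , s ⇒ᶜ⟨ n ⟩ s' →
                       Agree V s u → inline m q , u ⇒⟨ n * (6 * S) ⟩[ V ] s'
    inline-simulates {q = r ≔ a} q⊆V q≤S Assign s≈u =
      _ , _ , *-monoʳ-≤ 2 (suc≤⇒1≤6* q≤S) , Assign ,
      Agree-[:=] r s≈u (aval-agree a (q⊆V ∘ there) s≈u)
    inline-simulates q⊆V q≤S (Seq {n₁ = n₁} {n₂ = n₂} run₁ run₂) s≈u =
      let k₁ , u₁ , k₁≤ , run₁' , s₁≈u₁ =
            inline-simulates (q⊆V ∘ xs⊆xs++ys _ _) (m+n<o⇒m≤o q≤S) run₁ s≈u
          k₂ , u₂ , k₂≤ , run₂' , s₂≈u₂ =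
            inline-simulates (q⊆V ∘ xs⊆ys++xs _ _) (m+n<o⇒n≤o q≤S) run₂ s₁≈u₁
      in k₁ + k₂ , u₂ , ≤-*-distrib-+ n₁ n₂ k₁≤ k₂≤ , Seq run₁' run₂' , s₂≈u₂
    inline-simulates q⊆V q≤S (IfTrue {n = n} r≡ run) s≈u =
      let k , u' , k≤ , run' , s'≈u' =
            inline-simulates (q⊆V ∘ there ∘ xs⊆xs++ys _ _) (m+n<o⇒m≤o q≤S) run s≈u
      in suc k , u' , ≤-*-suc n (suc≤⇒1≤6* q≤S) k≤ ,
         IfTrue (Agree-guard s≈u q⊆V r≡) run' , s'≈u'
    inline-simulates q⊆V q≤S (IfFalse {n = n} r≡ run) s≈u =
      let k , u' , k≤ , run' , s'≈u' =
            inline-simulates (q⊆V ∘ there ∘ xs⊆ys++xs _ _) (m+n<o⇒n≤o q≤S) run s≈u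
      in suc k , u' , ≤-*-suc n (suc≤⇒1≤6* q≤S) k≤ ,
         IfFalse (Agree-guard s≈u q⊆V r≡) run' , s'≈u'
    inline-simulates {u = u} q⊆V q≤S (WhileFalse r≡) s≈u =
      2 , u , *-monoʳ-≤ 2 (suc≤⇒1≤6* q≤S) , WhileFalse (Agree-guard s≈u q⊆V r≡) , s≈u
    inline-simulates q⊆V q≤S (WhileTrue {n₁ = n₁} {n₂ = n₂} r≡ run₁ run₂) s≈u =
      let k₁ , u₁ , k₁≤ , run₁' , s₁≈u₁ = inline-simulates (q⊆V ∘ there) (<⇒≤ q≤S) run₁ s≈u
          k₂ , u₂ , k₂≤ , run₂' , s₂≈u₂ = inline-simulates q⊆V q≤S run₂ s₁≈u₁
      in suc (k₁ + k₂) , u₂ , ≤-*-suc (n₁ + n₂) (suc≤⇒1≤6* q≤S) (≤-*-distrib-+ n₁ n₂ k₁≤ k₂≤) ,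
         WhileTrue (Agree-guard s≈u q⊆V r≡) run₁' run₂' , s₂≈u₂
    inline-simulates {q = CALL pc RETURN r} q⊆V q≤S (Call n'≤n run refl) s≈u =
      let t , run' , s'≈t = rename-simulates (vars⊆callRegs pc r) run
                              (call-entry (q⊆V ∘ callRegs⊆varsC pc r) s≈u)
      in _ , _ , call-time (⇒-time-positive run) n'≤n q≤S ,
         copyIn-run (callRegs pc r) (Seq run' Assign) , call-exit (∈-callRegs pc r) s≈u s'≈t run'

    inline-reflects : ∀ q {s u u' n} → varsC q ⊆ V → inline m q , u ⇒⟨ n ⟩ u' → Agree V s u →
                      ∃ λ s' → (q , s ⇒ᶜ⟨ n ⟩ s') × Agree V s' u'
    inline-reflects (r ≔ a) q⊆V Assign s≈u =
      _ , Assign , Agree-[:=] r s≈u (aval-agree a (q⊆V ∘ there) s≈u)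
    inline-reflects (p₁ ⨾ p₂) q⊆V (Seq run₁ run₂) s≈u =
      let s₁ , run₁' , s₁≈u₁ = inline-reflects p₁ (q⊆V ∘ xs⊆xs++ys _ _) run₁ s≈u
          s₂ , run₂' , s₂≈u₂ = inline-reflects p₂ (q⊆V ∘ xs⊆ys++xs _ _) run₂ s₁≈u₁
      in s₂ , Seq run₁' run₂' , s₂≈u₂
    inline-reflects (IF r THEN p₁ ELSE _) q⊆V (IfTrue r≡ run) s≈u =
      let s' , run' , s'≈u' = inline-reflects p₁ (q⊆V ∘ there ∘ xs⊆xs++ys _ _) run s≈u
      in s' , IfTrue (Agree-guard (Agree-sym s≈u) q⊆V r≡) run' , s'≈u'
    inline-reflects (IF r THEN _ ELSE p₂) q⊆V (IfFalse r≡ run) s≈u =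
      let s' , run' , s'≈u' = inline-reflects p₂ (q⊆V ∘ there ∘ xs⊆ys++xs _ _) run s≈u
      in s' , IfFalse (Agree-guard (Agree-sym s≈u) q⊆V r≡) run' , s'≈u'
    inline-reflects (WHILE r DO _) {s} q⊆V (WhileFalse r≡) s≈u =
      s , WhileFalse (Agree-guard (Agree-sym s≈u) q⊆V r≡) , s≈u
    inline-reflects (WHILE r DO p) q⊆V (WhileTrue r≡ run₁ run₂) s≈u =
      let s₁ , run₁' , s₁≈u₁ = inline-reflects p (q⊆V ∘ there) run₁ s≈u
          s₂ , run₂' , s₂≈u₂ = inline-reflects (WHILE r DO p) q⊆V run₂ s₁≈u₁
      in s₂ , WhileTrue (Agree-guard (Agree-sym s≈u) q⊆V r≡) run₁' run₂' , s₂≈u₂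
    inline-reflects (CALL pc RETURN r) q⊆V run s≈u with copyIn-inv (callRegs pc r) run
    ... | _ , refl , Seq {n₁ = n₁} run' Assign =
      let s' , run'' , s'≈t = rename-reflects pc (vars⊆callRegs pc r) run'
                               (call-entry (q⊆V ∘ callRegs⊆varsC pc r) s≈u)
      in _ , Call (≤-trans (m≤m+n n₁ 2) (m≤n+m _ (length (callRegs pc r) * 2))) run'' refl ,
         call-exit (∈-callRegs pc r) s≈u s'≈t run'

mainTheorem3 : ∃ λ (c : ℕ) → ∃ λ (d : ℕ) →
    ∀ (m : Reg → Reg) (p : CCom) → Injective _≡_ _≡_ m → (∀ x → m x ∉ varsC p) →
    ∀ (s s' : State) (n : ℕ) →
      (p , s ⇒ᶜ⟨ n ⟩[ varsC p ] s' → inline m p , s ⇒⟨ c * n * sizeC p + d ⟩[ varsC p ] s')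
      × (inline m p , s ⇒⟨ n ⟩[ varsC p ] s' → p , s ⇒ᶜ⟨ n ⟩[ varsC p ] s')
mainTheorem3 = 6 , 0 , λ m p m-inj mx∉p s s' n →
  (λ (n' , s'' , n'≤n , run , s'≈s'') →
     ⇒[]-mono (time≤ n'≤n) s'≈s''
       (inline-simulates m m-inj (varsC p) mx∉p id ≤-refl run Agree-refl))
  , (λ (n' , u' , n'≤n , run , s'≈u') →
     let s'' , run' , s''≈u' = inline-reflects m m-inj (varsC p) mx∉p p id run Agree-refl
     in n' , s'' , n'≤n , run' , Agree-trans s'≈u' (Agree-sym s''≈u'))
  where
  time≤ : ∀ {n' n S} → n' ≤ n → n' * (6 * S) ≤ 6 * n * S + 0
  time≤ {n = n} {S} n'≤n = ≤-trans (*-monoˡ-≤ (6 * S) n'≤n) (≤-reflexive (reassociate n S))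
    where
    reassociate : ∀ n S → n * (6 * S) ≡ 6 * n * S + 0
    reassociate = solve-∀
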